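{- Every permutation in the symmetric group $S_n$ has a unique reduced expression $s_{i_1}\circ\cdots\circ s_{i_k}$ with all of the following properties: (1) $s_i$ is never immediately followed by $s_j$ for any $j>i+1$; (2) no three consecutive factors are $s_{i+1}\circ s_i\circ s_{i+1}$ for any $i$; (3) no reduced expression in the commutation class of $s_{i_1}\circ\cdots\circ s_{i_k}$ contains three consecutive factors $s_{i+1}\circ s_i\circ s_{i+1}$.
   Context: $s_i$ denotes the adjacent transposition $(i,i+1)$, $1\le i\le n-1$. A reduced expression for a permutation is an expression as a product of adjacent transpositions of minimal possible length. The commutation class of a reduced expression is the set of reduced expressions obtainable from it by repeatedly applying commutation relations $s_i\circ s_j=s_j\circ s_i$ with $|i-j|>1$ to consecutive factors. -}

module Defs where

open import Data.Nat using (ℕ; zero; suc; pred; _<_; _≤_)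
open import Data.Fin using (Fin; toℕ; inject₁)
import Data.Fin.Permutation as P
open import Data.Fin.Permutation using (Permutation′; _⟨$⟩ʳ_)
open import Data.List using (List; []; _∷_; _++_; length)
open import Data.Product using (∃; _×_)
open import Data.Sum using (_⊎_)
open import Relation.Binary.PropositionalEquality using (_≡_)
open import Relation.Nullary using (¬_)
open import Relation.Binary.Construct.Closure.ReflexiveTransitive using (Star)

-- A letter of S_n: ltr i with i : Fin (pred n) stands for the adjacent transposition
-- s_{toℕ i + 1}, which swaps the (0-indexed) points inject₁ i and suc i of Fin n.
record Letter (n : ℕ) : Set where
  constructor ltr
  field fin : Fin (pred n)
open Letter public

idx : ∀ {n} → Letter n → ℕ
idx i = suc (toℕ (fin i))

s : (n : ℕ) → Letter n → Permutation′ n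
s zero (ltr ())
s (suc m) (ltr i) = P.transpose (inject₁ i) (Data.Fin.suc i)

Word : ℕ → Set
Word n = List (Letter n)

eval : ∀ {n} → Word n → Fin n → Fin n
eval {n} [] x = x
eval {n} (i ∷ w) x = s n i ⟨$⟩ʳ eval w x

IsReducedExprFor : ∀ {n} → Word n → Permutation′ n → Set
IsReducedExprFor {n} w σ =
  (∀ x → eval w x ≡ σ ⟨$⟩ʳ x) ×
  (∀ (w′ : Word n) → (∀ x → eval w′ x ≡ σ ⟨$⟩ʳ x) → length w ≤ length w′)

data CommStep {n} : Word n → Word n → Set where
  comm : ∀ (u v : Word n) (a b : Letter n) →
         (suc (idx a) < idx b ⊎ suc (idx b) < idx a) →
         CommStep (u ++ a ∷ b ∷ v) (u ++ b ∷ a ∷ v)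

_∼ᶜ_ : ∀ {n} → Word n → Word n → Set
_∼ᶜ_ = Star CommStep

HasBadAscent : ∀ {n} → Word n → Set
HasBadAscent {n} w = ∃ λ (u : Word n) → ∃ λ (v : Word n) → ∃ λ (a : Letter n) → ∃ λ (b : Letter n) →
  (w ≡ u ++ a ∷ b ∷ v) × (suc (idx a) < idx b)

HasPattern : ∀ {n} → Word n → Set
HasPattern {n} w = ∃ λ (u : Word n) → ∃ λ (v : Word n) → ∃ λ (a : Letter n) → ∃ λ (b : Letter n) →
  (w ≡ u ++ a ∷ b ∷ a ∷ v) × (idx a ≡ suc (idx b))

Good : ∀ {n} → Word n → Set
Good {n} w =
  ¬ HasBadAscent w ×
  ¬ HasPattern w ×
  (∀ (w′ : Word n) → w ∼ᶜ w′ → ¬ HasPattern w′)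

-- A canonical word is a product of ascending runs s_(c+1) s_(c+2) ⋯ s_(c+k+1) whose top
-- letters strictly decrease.  Every permutation has one: a first run moves the last value into
-- place and the remaining permutation is treated recursively.  Its length is the number of
-- inversions, which every word must reach since each letter changes the inversion count by at
-- most one, so it is reduced.  It has no ascent by more than one, and scanning only the letters
-- i, i + 1, i + 2 gives an invariant of commutation classes that separates it from every word
-- containing s_(i+1) s_i s_(i+1).  Conversely, in a reduced word with (1)–(3) consecutive letters
-- rise by at most one and never repeat, so it splits into ascending runs; their tops decrease,
-- for otherwise a letter e + 1 is followed by a run through e and e + 1, and commuting it
-- rightwards produces s_(e+1) s_e s_(e+1).  A canonical word is determined by its permutation.

module Submission where

open import Defs
open import Data.Bool using (Bool; true; false; _∧_; _∨_; not)
open import Data.Bool.Properties using (∨-zeroʳ; ∧-zeroʳ)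
open import Data.Empty using (⊥; ⊥-elim)
import Data.Fin as F
open import Data.Fin using (Fin; toℕ; fromℕ<; inject₁)
import Data.Fin.Permutation as Perm
open import Data.Fin.Permutation using (Permutation′; _⟨$⟩ʳ_; _⟨$⟩ˡ_)
import Data.Fin.Permutation.Components as PC
open import Data.Fin.Properties using (toℕ<n; toℕ-injective; toℕ-fromℕ<; fromℕ<-toℕ; toℕ-inject₁)
open import Data.List using (List; []; _∷_; _++_; [_]; length; map; foldr; foldl)
open import Data.List.Properties
  using (foldr-++; foldl-++; map-id; map-cong-local; ++-assoc; map-++; map-∘; length-map; length-++; map-injective; ∷-injective)
open import Data.List.Relation.Unary.All as All using (All; []; _∷_)
open import Data.List.Relation.Unary.All.Properties using (++⁺; map⁺; map⁻)
open import Data.List.Relation.Unary.Linked as Linked using (Linked; [-]; _∷_)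
open import Data.Nat using (ℕ; zero; suc; pred; _+_; _∸_; _≤_; _<_; _≟_; _<?_; _≤?_; _≡ᵇ_; z≤n; s≤s)
open import Data.Nat.Properties
open import Algebra.Properties.CommutativeSemigroup +-commutativeSemigroup using (x∙yz≈y∙xz; interchange)
open import Data.Product using (Σ; ∃; ∃₂; _×_; _,_; proj₁; proj₂)
open import Data.Sum using (_⊎_; inj₁; inj₂)
open import Function using (_∘_)
open import Function.Bundles using (mk⇔)
open import Relation.Binary.Construct.Closure.ReflexiveTransitive using (ε; _◅_)
open import Relation.Binary.Definitions using (tri<; tri≈; tri>)
open import Relation.Binary.PropositionalEquality hiding ([_])
open import Relation.Nullary using (¬_; yes; no; does; contradiction)
open import Relation.Nullary.Decidable using (dec-true; dec-false; does-⇔)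

-- Adjacent transpositions acting on ℕ

-- swap k is s_k on 0-indexed points, exchanging k ∸ 1 and k as in Defs; swap 0 is a junk identity.
swap : ℕ → ℕ → ℕ
swap zero    y = y
swap (suc c) y with y ≟ c
... | yes _ = suc c
... | no _ with y ≟ suc c
...   | yes _ = c
...   | no _  = y

swap-lower : ∀ c → swap (suc c) c ≡ suc c
swap-lower c with c ≟ c
... | yes _   = refl
... | no c≢c = contradiction refl c≢c

swap-upper : ∀ c → swap (suc c) (suc c) ≡ c
swap-upper c with suc c ≟ c
... | yes 1+c≡c = contradiction 1+c≡c (1+n≢n)
... | no _ with suc c ≟ suc c
...   | yes _ = refl
...   | no ne = contradiction refl ne

swap-fix : ∀ c y → y ≢ c → y ≢ suc c → swap (suc c) y ≡ y
swap-fix c y y≢c y≢1+c with y ≟ c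
... | yes y≡c = contradiction y≡c y≢c
... | no _ with y ≟ suc c
...   | yes y≡1+c = contradiction y≡1+c y≢1+c
...   | no _      = refl

swap-fix-far : ∀ k y → suc y < k ⊎ k < y → swap k y ≡ y
swap-fix-far zero    y _ = refl
swap-fix-far (suc c) y far = swap-fix c y (λ { refl → apart far ≤-refl (n≤1+n y) })
                                           (λ { refl → apart far (n≤1+n y) ≤-refl })
  where
  apart : suc y < suc c ⊎ suc c < y → suc c ≤ suc y → y ≤ suc c → ⊥
  apart (inj₁ lt) le _ = <-irrefl refl (<-≤-trans lt le)
  apart (inj₂ lt) _ le = <-irrefl refl (<-≤-trans lt le)

swap-involutive : ∀ k y → swap k (swap k y) ≡ y
swap-involutive zero    y = refl
swap-involutive (suc c) y with y ≟ c
... | yes refl = swap-upper c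
... | no y≢c with y ≟ suc c
...   | yes refl  = swap-lower c
...   | no y≢1+c = swap-fix c y y≢c y≢1+c

swap-injective : ∀ k {x y} → swap k x ≡ swap k y → x ≡ y
swap-injective k {x} {y} eq = begin
  x                   ≡⟨ swap-involutive k x ⟨
  swap k (swap k x)   ≡⟨ cong (swap k) eq ⟩
  swap k (swap k y)   ≡⟨ swap-involutive k y ⟩
  y                   ∎
  where open ≡-Reasoning

evalℕ : List ℕ → ℕ → ℕ
evalℕ w y = foldr swap y w

evalℕ-++ : ∀ u v y → evalℕ (u ++ v) y ≡ evalℕ u (evalℕ v y)
evalℕ-++ u v y = foldr-++ swap y u v

evalℕ-injective : ∀ w {x y} → evalℕ w x ≡ evalℕ w y → x ≡ y
evalℕ-injective []      eq = eq
evalℕ-injective (k ∷ w) eq = evalℕ-injective w (swap-injective k eq)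

evalℕ-fix : ∀ w y → All (λ k → suc y < k ⊎ k < y) w → evalℕ w y ≡ y
evalℕ-fix []      y []            = refl
evalℕ-fix (k ∷ w) y (far ∷ w-far) rewrite evalℕ-fix w y w-far = swap-fix-far k y far

ascent : ℕ → ℕ → List ℕ
ascent a zero    = []
ascent a (suc k) = a ∷ ascent (suc a) k

length-ascent : ∀ a k → length (ascent a k) ≡ k
length-ascent a zero    = refl
length-ascent a (suc k) = cong suc (length-ascent (suc a) k)

ascent-++ : ∀ a m m′ → ascent a (m + m′) ≡ ascent a m ++ ascent (a + m) m′
ascent-++ a zero    m′ rewrite +-identityʳ a = refl
ascent-++ a (suc m) m′ rewrite +-suc a m    = cong (a ∷_) (ascent-++ (suc a) m m′)

ascent-snoc : ∀ a m → ascent a (suc m) ≡ ascent a m ++ [ a + m ]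
ascent-snoc a m = trans (cong (ascent a) (+-comm 1 m)) (ascent-++ a m 1)

ascent-all : ∀ {P : ℕ → Set} a k → (∀ {x} → a ≤ x → x < a + k → P x) → All P (ascent a k)
ascent-all a zero    _ = []
ascent-all a (suc k) p =
  p ≤-refl (subst (a <_) (sym (+-suc a k)) (s≤s (m≤m+n a k)))
  ∷ ascent-all (suc a) k (λ {x} a<x x<a+k → p (<⇒≤ a<x) (subst (x <_) (sym (+-suc a k)) x<a+k))

-- evalℕ (ascent (suc c) k) is the cycle c ↦ c + 1 ↦ ⋯ ↦ c + k ↦ c.
evalℕ-ascent-below : ∀ c k y → y < c → evalℕ (ascent (suc c) k) y ≡ y
evalℕ-ascent-below c k y y<c =
  evalℕ-fix _ y (ascent-all (suc c) k (λ 1+c≤x _ → inj₁ (≤-trans (s≤s y<c) 1+c≤x)))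

evalℕ-ascent-shift : ∀ c k y → c ≤ y → y < c + k → evalℕ (ascent (suc c) k) y ≡ suc y
evalℕ-ascent-shift c zero    y c≤y y<c+0 = contradiction (<-≤-trans y<c+0 (≤-reflexive (+-identityʳ c))) (≤⇒≯ c≤y)
evalℕ-ascent-shift c (suc k) y c≤y y<c+1+k with m≤n⇒m<n∨m≡n c≤y
... | inj₂ refl rewrite evalℕ-ascent-below (suc c) k c (n<1+n c) = swap-lower c
... | inj₁ c<y rewrite evalℕ-ascent-shift (suc c) k y c<y (subst (y <_) (+-suc c k) y<c+1+k) =
  swap-fix c (suc y) (λ 1+y≡c → <-asym c<y (subst (_≤ c) (sym 1+y≡c) ≤-refl))
                     (λ 1+y≡1+c → <-irrefl (sym (suc-injective 1+y≡1+c)) c<y)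

evalℕ-ascent-top : ∀ c k → evalℕ (ascent (suc c) k) (c + k) ≡ c
evalℕ-ascent-top c zero    = +-identityʳ c
evalℕ-ascent-top c (suc k) rewrite +-suc c k | evalℕ-ascent-top (suc c) k = swap-upper c

-- Canonical words

data Canonical : ℕ → List ℕ → Set where
  []  : ∀ {b} → Canonical b []
  run : ∀ {b r} c k → suc (c + k) < b → Canonical (suc (c + k)) r →
        Canonical b (ascent (suc c) (suc k) ++ r)

Canonical-weaken : ∀ {b b′ l} → b ≤ b′ → Canonical b l → Canonical b′ l
Canonical-weaken b≤b′ []              = []
Canonical-weaken b≤b′ (run c k t<b p) = run c k (<-≤-trans t<b b≤b′) p

Canonical-letters : ∀ {b l} → Canonical b l → All (λ z → 1 ≤ z × z < b) l
Canonical-letters [] = []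
Canonical-letters (run c k t<b p) = ++⁺
  (ascent-all (suc c) (suc k) λ 1+c≤x x<top →
    ≤-trans (s≤s z≤n) 1+c≤x , ≤-<-trans (≤-trans (≤-pred x<top) (≤-reflexive (+-suc c k))) t<b)
  (All.map (λ (1≤z , z<top) → 1≤z , <-trans z<top t<b) (Canonical-letters p))

evalℕ-canonical-fix : ∀ {b l} → Canonical b l → ∀ y → b ≤ y → evalℕ l y ≡ y
evalℕ-canonical-fix p y b≤y =
  evalℕ-fix _ y (All.map (λ (_ , z<b) → inj₂ (<-≤-trans z<b b≤y)) (Canonical-letters p))

data TopView (m : ℕ) : List ℕ → Set where
  under : ∀ {l} → Canonical m l → TopView m l
  top   : ∀ c k {r} → suc (c + k) ≡ m → Canonical m r → TopView m (ascent (suc c) (suc k) ++ r)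

topView : ∀ {m l} → Canonical (suc m) l → TopView m l
topView [] = under []
topView {m} (run c k t<b p) with m≤n⇒m<n∨m≡n (≤-pred t<b)
... | inj₁ t<m = under (run c k t<m p)
... | inj₂ refl  = top c k refl p

evalℕ-top : ∀ c k {m r} → suc (c + k) ≡ m → Canonical m r → evalℕ (ascent (suc c) (suc k) ++ r) m ≡ c
evalℕ-top c k {r = r} refl p = begin
  evalℕ (ascent (suc c) (suc k) ++ r) (suc (c + k))        ≡⟨ evalℕ-++ (ascent (suc c) (suc k)) r _ ⟩
  evalℕ (ascent (suc c) (suc k)) (evalℕ r (suc (c + k)))   ≡⟨ cong (evalℕ (ascent (suc c) (suc k))) (evalℕ-canonical-fix p _ ≤-refl) ⟩
  evalℕ (ascent (suc c) (suc k)) (suc (c + k))             ≡⟨ cong (evalℕ (ascent (suc c) (suc k))) (+-suc c k) ⟨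
  evalℕ (ascent (suc c) (suc k)) (c + suc k)               ≡⟨ evalℕ-ascent-top c (suc k) ⟩
  c                                                         ∎
  where open ≡-Reasoning

SameOn : ℕ → List ℕ → List ℕ → Set
SameOn m l l′ = ∀ {x} → x < m → evalℕ l x ≡ evalℕ l′ x

top-moved : ∀ c k {m} → suc (c + k) ≡ m → c ≢ m
top-moved c k refl c≡top = <-irrefl c≡top (s≤s (m≤m+n c k))

-- Evaluating at the point m decides whether a canonical word reaches the top letter m and
-- with which run; the remaining runs are then recovered by induction.
canonical-unique : ∀ m {l l′} → Canonical m l → Canonical m l′ → SameOn m l l′ → l ≡ l′
canonical-unique zero [] [] _ = refl
canonical-unique (suc m) p p′ same with topView p | topView p′
... | under q | under q′ = canonical-unique m q q′ (λ x<m → same (m<n⇒m<1+n x<m))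
... | under q | top c k e q′ = contradiction
  (trans (sym (evalℕ-top c k e q′)) (trans (sym (same {m} ≤-refl)) (evalℕ-canonical-fix q m ≤-refl)))
  (top-moved c k e)
... | top c k e q | under q′ = contradiction
  (trans (sym (evalℕ-top c k e q)) (trans (same {m} ≤-refl) (evalℕ-canonical-fix q′ m ≤-refl)))
  (top-moved c k e)
... | top c k {r} e q | top c′ k′ {r′} e′ q′
  with refl ← trans (sym (evalℕ-top c k e q)) (trans (same {m} ≤-refl) (evalℕ-top c′ k′ e′ q′))
  with refl ← +-cancelˡ-≡ c k k′ (suc-injective (trans e (sym e′))) =
  cong (ascent (suc c) (suc k) ++_) (canonical-unique m q q′ λ {x} x<m →
    evalℕ-injective (ascent (suc c) (suc k))
      (trans (sym (evalℕ-++ (ascent (suc c) (suc k)) r x)) (trans (same (m<n⇒m<1+n x<m)) (evalℕ-++ (ascent (suc c) (suc k)) r′ x))))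

-- Inversions

bit : Bool → ℕ
bit false = 0
bit true  = 1

count : (ℕ → Bool) → List ℕ → ℕ
count p []       = 0
count p (y ∷ ys) = bit (p y) + count p ys

below above atLeast : ℕ → ℕ → Bool
below   x y = does (y <? x)
above   x y = does (x <? y)
atLeast x y = does (x ≤? y)

inversions : List ℕ → ℕ
inversions []       = 0
inversions (x ∷ xs) = count (below x) xs + inversions xs

count-++ : ∀ p xs ys → count p (xs ++ ys) ≡ count p xs + count p ys
count-++ p []       ys = refl
count-++ p (x ∷ xs) ys = trans (cong (bit (p x) +_) (count-++ p xs ys)) (sym (+-assoc (bit (p x)) _ _))

count-map : ∀ p q g {L} → All (λ y → p (g y) ≡ q y) L → count p (map g L) ≡ count q L
count-map p q g []       = refl
count-map p q g (e ∷ es) = cong₂ _+_ (cong bit e) (count-map p q g es)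

count-swap : ∀ p xs x y ys → count p (xs ++ y ∷ x ∷ ys) ≡ count p (xs ++ x ∷ y ∷ ys)
count-swap p []       x y ys = x∙yz≈y∙xz (bit (p y)) (bit (p x)) (count p ys)
count-swap p (z ∷ xs) x y ys = cong (bit (p z) +_) (count-swap p xs x y ys)

count-none : ∀ p {L} → All (λ y → p y ≡ false) L → count p L ≡ 0
count-none p []           = refl
count-none p (px ∷ ps) rewrite px = count-none p ps

bit≤suc : ∀ b b′ → bit b ≤ suc (bit b′)
bit≤suc false _ = z≤n
bit≤suc true  _ = s≤s z≤n

inversions-swap : ∀ xs x y ys → inversions (xs ++ y ∷ x ∷ ys) ≤ suc (inversions (xs ++ x ∷ y ∷ ys))
inversions-swap [] x y ys = begin
  (bit (below y x) + A) + (B + I)   ≡⟨ interchange (bit (below y x)) A B I ⟩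
  (bit (below y x) + B) + (A + I)   ≤⟨ +-monoˡ-≤ (A + I) (+-monoˡ-≤ B (bit≤suc (below y x) (below x y))) ⟩
  suc ((bit (below x y) + B) + (A + I)) ∎
  where
  open ≤-Reasoning
  A = count (below y) ys
  B = count (below x) ys
  I = inversions ys
inversions-swap (z ∷ xs) x y ys rewrite count-swap (below z) xs x y ys =
  ≤-trans (+-monoʳ-≤ (count (below z) (xs ++ x ∷ y ∷ ys)) (inversions-swap xs x y ys))
          (≤-reflexive (+-suc (count (below z) (xs ++ x ∷ y ∷ ys)) (inversions (xs ++ x ∷ y ∷ ys))))

inversions-map : ∀ {P : ℕ → Set} (g : ℕ → ℕ) → (∀ {x y} → P x → P y → x < y → g x < g y) →
                 ∀ {L} → All P L → inversions (map g L) ≡ inversions L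
inversions-map {P} g increasing []         = refl
inversions-map {P} g increasing {x ∷ _} (px ∷ pL) = cong₂ _+_
  (count-map (below (g x)) (below x) g (All.map (λ {y} py → does-⇔ (mk⇔ (reflects px py) (preserves px py)) (g y <? g x) (y <? x)) pL))
  (inversions-map g increasing pL)
  where
  preserves : ∀ {x y} → P x → P y → y < x → g y < g x
  preserves px py = increasing py px
  reflects : ∀ {x y} → P x → P y → g y < g x → y < x
  reflects {x} {y} px py gy<gx with <-cmp y x
  ... | tri< y<x _ _ = y<x
  ... | tri≈ _ refl _ = contradiction gy<gx (<-irrefl refl)
  ... | tri> _ _ x<y = contradiction (increasing px py x<y) (<-asym gy<gx)

inversions-snoc : ∀ xs z → inversions (xs ++ [ z ]) ≡ inversions xs + count (above z) xs
inversions-snoc []       z = refl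
inversions-snoc (x ∷ xs) z = begin
  count (below x) (xs ++ [ z ]) + inversions (xs ++ [ z ])
    ≡⟨ cong₂ _+_ (trans (count-++ (below x) xs [ z ]) (cong (count (below x) xs +_) (+-identityʳ _))) (inversions-snoc xs z) ⟩
  (count (below x) xs + bit (below x z)) + (inversions xs + count (above z) xs)
    ≡⟨ interchange (count (below x) xs) (bit (below x z)) (inversions xs) (count (above z) xs) ⟩
  (count (below x) xs + inversions xs) + (bit (below x z) + count (above z) xs)
    ∎
  where open ≡-Reasoning

inversions-ascent : ∀ a m → inversions (ascent a m) ≡ 0
inversions-ascent a zero    = refl
inversions-ascent a (suc m) rewrite count-none (below a)
  (ascent-all (suc a) m λ a<y _ → dec-false (_ <? a) (<-asym a<y)) = inversions-ascent (suc a) m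

oneLine : ℕ → (ℕ → ℕ) → List ℕ
oneLine n f = map f (ascent 0 n)

oneLine-cong : ∀ n {g h} → (∀ {x} → x < n → g x ≡ h x) → oneLine n g ≡ oneLine n h
oneLine-cong n g≗h = map-cong-local (ascent-all 0 n (λ _ x<n → g≗h x<n))

oneLine-split : ∀ c d f → oneLine (c + suc (suc d)) f ≡ map f (ascent 0 c) ++ f c ∷ f (suc c) ∷ map f (ascent (suc (suc c)) d)
oneLine-split c d f = trans (cong (map f) (ascent-++ 0 c (suc (suc d)))) (map-++ f (ascent 0 c) _)

oneLine-swap : ∀ c d f → oneLine (c + suc (suc d)) (f ∘ swap (suc c)) ≡
                         map f (ascent 0 c) ++ f (suc c) ∷ f c ∷ map f (ascent (suc (suc c)) d)
oneLine-swap c d f = trans (oneLine-split c d (f ∘ swap (suc c))) (cong₂ _++_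
  (map-cong-local (ascent-all 0 c λ _ x<c → cong f (swap-fix-far (suc c) _ (inj₁ (s≤s x<c)))))
  (cong₂ _∷_ (cong f (swap-lower c)) (cong₂ _∷_ (cong f (swap-upper c))
    (map-cong-local (ascent-all (suc (suc c)) d λ 1+c<x _ → cong f (swap-fix-far (suc c) _ (inj₂ 1+c<x)))))))

inversions-oneLine-swap : ∀ {n} k f → k < n → inversions (oneLine n (f ∘ swap k)) ≤ suc (inversions (oneLine n f))
inversions-oneLine-swap zero    f _ = n≤1+n _
inversions-oneLine-swap (suc c) f 1+c<n
  with d , 2+c+d≡n ← m≤n⇒∃[o]m+o≡n 1+c<n
  with refl ← trans (trans (+-suc c (suc d)) (cong suc (+-suc c d))) 2+c+d≡n
  rewrite oneLine-swap c d f | oneLine-split c d f =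
  inversions-swap (map f (ascent 0 c)) (f c) (f (suc c)) (map f (ascent (suc (suc c)) d))

inversions-evalℕ : ∀ {n} w f → All (_< n) w →
                   inversions (oneLine n (f ∘ evalℕ w)) ≤ inversions (oneLine n f) + length w
inversions-evalℕ {n} []      f []          = ≤-reflexive (sym (+-identityʳ _))
inversions-evalℕ {n} (k ∷ w) f (k<n ∷ w<n) = begin
  inversions (oneLine n (f ∘ swap k ∘ evalℕ w))   ≤⟨ inversions-evalℕ w (f ∘ swap k) w<n ⟩
  inversions (oneLine n (f ∘ swap k)) + length w  ≤⟨ +-monoˡ-≤ (length w) (inversions-oneLine-swap k f k<n) ⟩
  suc (inversions (oneLine n f)) + length w       ≡⟨ +-suc _ (length w) ⟨
  inversions (oneLine n f) + suc (length w)       ∎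
  where open ≤-Reasoning

inversions≤length : ∀ {n} w f → All (_< n) w → (∀ {x} → x < n → evalℕ w x ≡ f x) →
                    inversions (oneLine n f) ≤ length w
inversions≤length {n} w f w<n w≗f = begin
  inversions (oneLine n f)                          ≡⟨ cong inversions (oneLine-cong n w≗f) ⟨
  inversions (oneLine n (evalℕ w))                  ≤⟨ inversions-evalℕ w (λ y → y) w<n ⟩
  inversions (oneLine n (λ y → y)) + length w       ≡⟨ cong (_+ length w) (trans (cong inversions (map-id (ascent 0 n))) (inversions-ascent 0 n)) ⟩
  length w                                          ∎
  where open ≤-Reasoning

-- Existence of canonical words

record IsPermutationOn (n : ℕ) (f : ℕ → ℕ) : Set where
  field
    maps-to   : ∀ {x} → x < n → f x < n
    injective : ∀ {x y} → x < n → y < n → f x ≡ f y → x ≡ y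

-- f = ρ ∘ τ on {0, …, m - 1}, where ρ = evalℕ (ascent (suc c) k) shifts the values c, …, m - 1
-- up by one to make room for c = f m, and τ permutes {0, …, m - 1}.
module Peel {m : ℕ} {f : ℕ → ℕ} (perm : IsPermutationOn (suc m) f) where
  open IsPermutationOn perm

  c k : ℕ
  c = f m
  k = m ∸ c

  c≤m : c ≤ m
  c≤m = ≤-pred (maps-to ≤-refl)

  c+k≡m : c + k ≡ m
  c+k≡m = m+[n∸m]≡n c≤m

  ρ : ℕ → ℕ
  ρ = evalℕ (ascent (suc c) k)

  ρ-low : ∀ {y} → y < c → ρ y ≡ y
  ρ-low = evalℕ-ascent-below c k _

  ρ-high : ∀ {y} → c ≤ y → y < m → ρ y ≡ suc y
  ρ-high c≤y y<m = evalℕ-ascent-shift c k _ c≤y (subst (_ <_) (sym c+k≡m) y<m)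

  ρ-top : ρ m ≡ c
  ρ-top = subst (λ y → ρ y ≡ c) c+k≡m (evalℕ-ascent-top c k)

  ρ-increasing : ∀ {x y} → x < m → y < m → x < y → ρ x < ρ y
  ρ-increasing {x} {y} _ y<m x<y with x <? c | y <? c
  ... | yes x<c | yes y<c rewrite ρ-low x<c | ρ-low y<c = x<y
  ... | yes x<c | no  y≮c rewrite ρ-low x<c | ρ-high (≮⇒≥ y≮c) y<m = m<n⇒m<1+n x<y
  ... | no  x≮c | yes y<c = contradiction (<-trans x<y y<c) x≮c
  ... | no  x≮c | no  y≮c rewrite ρ-high (≮⇒≥ x≮c) (<-trans x<y y<m) | ρ-high (≮⇒≥ y≮c) y<m = s≤s x<y

  τ : ℕ → ℕ
  τ x with f x <? c
  ... | yes _ = f x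
  ... | no  _ = pred (f x)

  τ-spec : ∀ {x} → x < m → τ x < m × ρ (τ x) ≡ f x
  τ-spec {x} x<m with f x <? c
  ... | yes fx<c = <-≤-trans fx<c c≤m , ρ-low fx<c
  ... | no  fx≮c with f x | maps-to (m<n⇒m<1+n x<m) | injective (m<n⇒m<1+n x<m) ≤-refl
  ...   | zero   | _       | inj-m = contradiction (inj-m (sym (n≤0⇒n≡0 (≮⇒≥ fx≮c)))) (<⇒≢ x<m)
  ...   | suc v | 1+v≤m | inj-m = ≤-pred 1+v≤m , ρ-high c≤v (≤-pred 1+v≤m)
    where c≤v : c ≤ v
          c≤v = ≤-pred (≤∧≢⇒< (≮⇒≥ fx≮c) (λ c≡1+v → <⇒≢ x<m (inj-m (sym c≡1+v))))

  τ-perm : IsPermutationOn m τ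
  τ-perm = record
    { maps-to   = proj₁ ∘ τ-spec
    ; injective = λ x<m y<m τx≡τy → injective (m<n⇒m<1+n x<m) (m<n⇒m<1+n y<m)
        (trans (sym (proj₂ (τ-spec x<m))) (trans (cong ρ τx≡τy) (proj₂ (τ-spec y<m))))
    }

  oneLine-peel : oneLine (suc m) f ≡ map ρ (oneLine m τ) ++ [ c ]
  oneLine-peel = begin
    map f (ascent 0 (suc m))             ≡⟨ cong (map f) (ascent-snoc 0 m) ⟩
    map f (ascent 0 m ++ [ m ])          ≡⟨ map-++ f (ascent 0 m) [ m ] ⟩
    map f (ascent 0 m) ++ [ c ]          ≡⟨ cong (_++ [ c ]) (oneLine-cong m (λ x<m → sym (proj₂ (τ-spec x<m)))) ⟩
    map (ρ ∘ τ) (ascent 0 m) ++ [ c ]    ≡⟨ cong (_++ [ c ]) (map-∘ (ascent 0 m)) ⟩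
    map ρ (oneLine m τ) ++ [ c ]         ∎
    where open ≡-Reasoning

  count-ρ-low : ∀ {z L} → z ≤ c → All (_< m) L → count (atLeast z) (map ρ L) ≡ count (atLeast z) L
  count-ρ-low {z} z≤c = count-map (atLeast z) (atLeast z) ρ ∘ All.map same
    where
    same : ∀ {y} → y < m → atLeast z (ρ y) ≡ atLeast z y
    same {y} y<m with y <? c
    ... | yes y<c rewrite ρ-low y<c = refl
    ... | no  y≮c rewrite ρ-high (≮⇒≥ y≮c) y<m =
      trans (dec-true (z ≤? suc y) (≤-trans z≤c (≤-trans (≮⇒≥ y≮c) (n≤1+n y))))
            (sym (dec-true (z ≤? y) (≤-trans z≤c (≮⇒≥ y≮c))))

  count-ρ-high : ∀ {z L} → c ≤ z → All (_< m) L → count (atLeast (suc z)) (map ρ L) ≡ count (atLeast z) L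
  count-ρ-high {z} c≤z = count-map (atLeast (suc z)) (atLeast z) ρ ∘ All.map same
    where
    same : ∀ {y} → y < m → atLeast (suc z) (ρ y) ≡ atLeast z y
    same {y} y<m with y <? c
    ... | yes y<c rewrite ρ-low y<c =
      trans (dec-false (suc z ≤? y) (<⇒≱ (<-≤-trans y<c (≤-trans c≤z (n≤1+n z)))))
            (sym (dec-false (z ≤? y) (<⇒≱ (<-≤-trans y<c c≤z))))
    ... | no  y≮c rewrite ρ-high (≮⇒≥ y≮c) y<m = does-⇔ (mk⇔ ≤-pred s≤s) (suc z ≤? suc y) (z ≤? y)

oneLine-< : ∀ {n f} → IsPermutationOn n f → All (_< n) (oneLine n f)
oneLine-< {n} perm = map⁺ (ascent-all 0 n λ _ x<n → IsPermutationOn.maps-to perm x<n)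

count-atLeast : ∀ n {f} → IsPermutationOn n f → ∀ {z} → z ≤ n → count (atLeast z) (oneLine n f) ≡ n ∸ z
count-atLeast zero    _ {zero} _ = refl
count-atLeast (suc m) {f} perm {z} z≤1+m = begin
  count (atLeast z) (oneLine (suc m) f)                  ≡⟨ cong (count (atLeast z)) oneLine-peel ⟩
  count (atLeast z) (map ρ L ++ [ c ])                   ≡⟨ count-++ (atLeast z) (map ρ L) [ c ] ⟩
  count (atLeast z) (map ρ L) + count (atLeast z) [ c ]  ≡⟨ split z≤1+m ⟩
  suc m ∸ z                                              ∎
  where
  open ≡-Reasoning
  open Peel perm
  L = oneLine m τ
  split : ∀ {z} → z ≤ suc m → count (atLeast z) (map ρ L) + (bit (atLeast z c) + 0) ≡ suc m ∸ z
  split {z} _ with z ≤? c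
  ... | yes z≤c = begin
    count (atLeast z) (map ρ L) + (bit (atLeast z c) + 0)
      ≡⟨ cong₂ _+_ (count-ρ-low z≤c (oneLine-< τ-perm)) (cong (λ b → bit b + 0) (dec-true (z ≤? c) z≤c)) ⟩
    count (atLeast z) L + 1   ≡⟨ cong (_+ 1) (count-atLeast m τ-perm (≤-trans z≤c c≤m)) ⟩
    (m ∸ z) + 1               ≡⟨ +-comm (m ∸ z) 1 ⟩
    suc (m ∸ z)               ≡⟨ +-∸-assoc 1 (≤-trans z≤c c≤m) ⟨
    suc m ∸ z                 ∎
  split {zero}  _       | no z≰c = contradiction z≤n z≰c
  split {suc z} 1+z≤1+m | no z≰c = begin
    count (atLeast (suc z)) (map ρ L) + (bit (atLeast (suc z) c) + 0)
      ≡⟨ cong₂ _+_ (count-ρ-high (≤-pred (≰⇒> z≰c)) (oneLine-< τ-perm))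
                   (cong (λ b → bit b + 0) (dec-false (suc z ≤? c) z≰c)) ⟩
    count (atLeast z) L + 0   ≡⟨ +-identityʳ _ ⟩
    count (atLeast z) L       ≡⟨ count-atLeast m τ-perm (≤-pred 1+z≤1+m) ⟩
    m ∸ z                     ∎

record CanonicalFor (n : ℕ) (f : ℕ → ℕ) : Set where
  field
    word              : List ℕ
    canonical         : Canonical n word
    represents        : ∀ {x} → x < n → evalℕ word x ≡ f x
    length≡inversions : length word ≡ inversions (oneLine n f)

Canonical-prepend : ∀ c k {m r} → c + k ≡ m → Canonical m r → Canonical (suc m) (ascent (suc c) k ++ r)
Canonical-prepend c zero    {m} _ p = Canonical-weaken (n≤1+n m) p
Canonical-prepend c (suc k) {m} {r} e p =
  run c k (s≤s (≤-reflexive (trans (sym (+-suc c k)) e))) (subst (λ b → Canonical b r) (trans (sym e) (+-suc c k)) p)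

canonical-exists : ∀ n {f} → IsPermutationOn n f → CanonicalFor n f
canonical-exists zero    _    = record { word = [] ; canonical = [] ; represents = λ () ; length≡inversions = refl }
canonical-exists (suc m) {f} perm = record
  { word              = ascent (suc c) k ++ w
  ; canonical         = Canonical-prepend c k c+k≡m canonical
  ; represents        = represents′
  ; length≡inversions = length≡
  }
  where
  open Peel perm
  open CanonicalFor (canonical-exists m τ-perm) renaming (word to w)
  L = oneLine m τ

  represents′ : ∀ {x} → x < suc m → evalℕ (ascent (suc c) k ++ w) x ≡ f x
  represents′ {x} x<1+m rewrite evalℕ-++ (ascent (suc c) k) w x with m≤n⇒m<n∨m≡n (≤-pred x<1+m)
  ... | inj₁ x<m rewrite represents x<m = proj₂ (τ-spec x<m)
  ... | inj₂ refl rewrite evalℕ-canonical-fix canonical x ≤-refl = ρ-top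

  -- The last entry c of the one-line notation is preceded by exactly m ∸ c = k larger values.
  length≡ : length (ascent (suc c) k ++ w) ≡ inversions (oneLine (suc m) f)
  length≡ = begin
    length (ascent (suc c) k ++ w)                           ≡⟨ length-++ (ascent (suc c) k) ⟩
    length (ascent (suc c) k) + length w                     ≡⟨ cong₂ _+_ (length-ascent (suc c) k) length≡inversions ⟩
    k + inversions L                                         ≡⟨ +-comm k (inversions L) ⟩
    inversions L + k                                         ≡⟨ cong₂ _+_ (inversions-map ρ ρ-increasing (oneLine-< τ-perm))
                                                                          (trans (count-ρ-high ≤-refl (oneLine-< τ-perm)) (count-atLeast m τ-perm c≤m)) ⟨
    inversions (map ρ L) + count (above c) (map ρ L)         ≡⟨ inversions-snoc (map ρ L) c ⟨
    inversions (map ρ L ++ [ c ])                            ≡⟨ cong inversions oneLine-peel ⟨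
    inversions (oneLine (suc m) f)                           ∎
    where open ≡-Reasoning

-- Canonical words have no ascent by more than one

UpByAtMostOne : ℕ → ℕ → Set
UpByAtMostOne x y = y ≤ suc x

linked-weaken : ∀ {x x′ l} → x ≤ x′ → Linked UpByAtMostOne (x ∷ l) → Linked UpByAtMostOne (x′ ∷ l)
linked-weaken x≤x′ [-]       = [-]
linked-weaken x≤x′ (y≤ ∷ ys) = ≤-trans y≤ (s≤s x≤x′) ∷ ys

ascent-linked : ∀ a k {r} → Linked UpByAtMostOne (a + k ∷ r) → Linked UpByAtMostOne (a ∷ ascent (suc a) k ++ r)
ascent-linked a zero    {r} p = subst (λ x → Linked UpByAtMostOne (x ∷ r)) (+-identityʳ a) p
ascent-linked a (suc k) {r} p = ≤-refl ∷ ascent-linked (suc a) k (subst (λ x → Linked UpByAtMostOne (x ∷ r)) (+-suc a k) p)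

canonical-linked : ∀ {b l} → Canonical b l → Linked UpByAtMostOne (pred b ∷ l)
canonical-linked []               = [-]
canonical-linked (run c k t<b p) =
  linked-weaken (<⇒≤pred (<-trans (s≤s (m≤m+n c k)) t<b))
    (ascent-linked c (suc k) (linked-weaken (+-monoʳ-≤ c (n≤1+n k)) (canonical-linked p)))

linked-infix : ∀ {R : ℕ → ℕ → Set} u {x y v} → Linked R (u ++ x ∷ y ∷ v) → R x y
linked-infix []      (Rxy ∷ _) = Rxy
linked-infix (_ ∷ u) p         = linked-infix u (Linked.tail p)

-- A commutation invariant detecting the factor s_(i+1) s_i s_(i+1)

data Role : Set where
  low mid high other : Role

role : ℕ → ℕ → Role
role i x with x ≟ i
... | yes _ = low
... | no _ with x ≟ suc i
...   | yes _ = mid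
...   | no _ with x ≟ suc (suc i)
...     | yes _ = high
...     | no _  = other

data RoleView (i x : ℕ) : Role → Set where
  is-low   : x ≡ i → RoleView i x low
  is-mid   : x ≡ suc i → RoleView i x mid
  is-high  : x ≡ suc (suc i) → RoleView i x high
  is-other : x ≢ i → x ≢ suc i → x ≢ suc (suc i) → RoleView i x other

roleView : ∀ i x → RoleView i x (role i x)
roleView i x with x ≟ i
... | yes x≡i = is-low x≡i
... | no x≢i with x ≟ suc i
...   | yes x≡1+i = is-mid x≡1+i
...   | no x≢1+i with x ≟ suc (suc i)
...     | yes x≡2+i = is-high x≡2+i
...     | no x≢2+i  = is-other x≢i x≢1+i x≢2+i

-- Reading a word letter by letter, remember whether i + 1 occurred and, since its last
-- occurrence, how many letters i and whether some i + 2 were read.  Only the relative order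
-- of the letters i, i + 1, i + 2 matters, up to exchanging i and i + 2, so the final state is
-- invariant under commutation moves.
record Scan : Set where
  constructor scan
  field
    seenMid  : Bool
    lows     : ℕ
    sawHigh  : Bool
    found    : Bool
open Scan

step : Scan → Role → Scan
step s low   = record s { lows = suc (lows s) }
step s mid   = scan true 0 false ((seenMid s ∧ (lows s ≡ᵇ 1) ∧ not (sawHigh s)) ∨ found s)
step s high  = record s { sawHigh = true }
step s other = s

scanStep : ℕ → Scan → ℕ → Scan
scanStep i s x = step s (role i x)

scanWord : ℕ → Scan → List ℕ → Scan
scanWord i = foldl (scanStep i)

start : Scan
start = scan false 0 false false

Far : ℕ → ℕ → Set
Far x y = suc x < y ⊎ suc y < x

close-¬far : ∀ {x y} → y ≤ suc x → x ≤ suc y → ¬ Far x y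
close-¬far y≤1+x _ (inj₁ 1+x<y) = ≤⇒≯ y≤1+x 1+x<y
close-¬far _ x≤1+y (inj₂ 1+y<x) = ≤⇒≯ x≤1+y 1+y<x

step-far-comm : ∀ i s x y → Far x y → step (step s (role i x)) (role i y) ≡ step (step s (role i y)) (role i x)
step-far-comm i s x y far with role i x | roleView i x | role i y | roleView i y
... | other | _            | _     | _            = refl
... | low   | _            | other | _            = refl
... | mid   | _            | other | _            = refl
... | high  | _            | other | _            = refl
... | low   | _            | high  | _            = refl
... | high  | _            | low   | _            = refl
... | low   | is-low refl  | low   | is-low refl  = contradiction far (close-¬far (n≤1+n _) (n≤1+n _))
... | mid   | is-mid refl  | mid   | is-mid refl  = contradiction far (close-¬far (n≤1+n _) (n≤1+n _))
... | high  | is-high refl | high  | is-high refl = contradiction far (close-¬far (n≤1+n _) (n≤1+n _))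
... | low   | is-low refl  | mid   | is-mid refl  = contradiction far (close-¬far ≤-refl (m≤n⇒m≤1+n (n≤1+n _)))
... | mid   | is-mid refl  | low   | is-low refl  = contradiction far (close-¬far (m≤n⇒m≤1+n (n≤1+n _)) ≤-refl)
... | mid   | is-mid refl  | high  | is-high refl = contradiction far (close-¬far ≤-refl (m≤n⇒m≤1+n (n≤1+n _)))
... | high  | is-high refl | mid   | is-mid refl  = contradiction far (close-¬far (m≤n⇒m≤1+n (n≤1+n _)) ≤-refl)

scanWord-far-swap : ∀ i s u x y v → Far x y → scanWord i s (u ++ x ∷ y ∷ v) ≡ scanWord i s (u ++ y ∷ x ∷ v)
scanWord-far-swap i s u x y v far rewrite foldl-++ (scanStep i) s u (x ∷ y ∷ v)
                                        | foldl-++ (scanStep i) s u (y ∷ x ∷ v) =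
  cong (λ t → scanWord i t v) (step-far-comm i (scanWord i s u) x y far)

found-persists : ∀ i s v → found s ≡ true → found (scanWord i s v) ≡ true
found-persists i s []      f = f
found-persists i s (x ∷ v) f = found-persists i (step s (role i x)) v (found-step (role i x))
  where
  found-step : ∀ r → found (step s r) ≡ true
  found-step low   = f
  found-step mid   rewrite f = ∨-zeroʳ _
  found-step high  = f
  found-step other = f

role-low : ∀ i → role i i ≡ low
role-low i with role i i | roleView i i
... | low   | _                = refl
... | mid   | is-mid i≡1+i     = contradiction (sym i≡1+i) 1+n≢n
... | high  | is-high i≡2+i    = contradiction i≡2+i (<⇒≢ (<-trans (n<1+n i) (n<1+n (suc i))))
... | other | is-other i≢i _ _ = contradiction refl i≢i

role-mid : ∀ i → role i (suc i) ≡ mid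
role-mid i with role i (suc i) | roleView i (suc i)
... | low   | is-low 1+i≡i      = contradiction 1+i≡i 1+n≢n
... | mid   | _                 = refl
... | high  | is-high 1+i≡2+i   = contradiction (suc-injective 1+i≡2+i) (<⇒≢ (n<1+n i))
... | other | is-other _ ne _   = contradiction refl ne

scanWord-braid : ∀ i s u v → found (scanWord i s (u ++ suc i ∷ i ∷ suc i ∷ v)) ≡ true
scanWord-braid i s u v rewrite foldl-++ (scanStep i) s u (suc i ∷ i ∷ suc i ∷ v)
                             | role-mid i | role-low i = found-persists i _ v refl

-- Invariant of the scan of a canonical word whose remaining tops are below b, when the next
-- letter is x: after the last i + 1 an i + 2 was read, or x is that i + 2, or no i + 1 can follow.
CleanAt : ℕ → ℕ → ℕ → Scan → Set
CleanAt i b x s = found s ≡ false × (seenMid s ≡ true → sawHigh s ≡ true ⊎ x ≡ suc (suc i) ⊎ b ≤ suc i)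

skip-letter : ∀ {t i b x x′} → x ≢ suc (suc i) →
              t ≡ true ⊎ x ≡ suc (suc i) ⊎ b ≤ suc i → t ≡ true ⊎ x′ ≡ suc (suc i) ⊎ b ≤ suc i
skip-letter _    (inj₁ saw)          = inj₁ saw
skip-letter x≢2+i (inj₂ (inj₁ x≡2+i)) = contradiction x≡2+i x≢2+i
skip-letter _    (inj₂ (inj₂ b≤1+i)) = inj₂ (inj₂ b≤1+i)

CleanAt-step : ∀ i b x s → x < b → CleanAt i b x s → CleanAt i b (suc x) (step s (role i x))
CleanAt-step i b x s x<b (unfound , clean) with role i x | roleView i x
... | low | is-low refl =
  unfound , λ seen → skip-letter (<⇒≢ (<-trans (n<1+n _) (n<1+n (suc _)))) (clean seen)
... | mid | is-mid refl = unfound′ , λ _ → inj₂ (inj₁ refl)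
  where
  unfound′ : (seenMid s ∧ (lows s ≡ᵇ 1) ∧ not (sawHigh s)) ∨ found s ≡ false
  unfound′ with seenMid s
  ... | false = unfound
  ... | true with clean refl
  ...   | inj₁ saw rewrite saw | ∧-zeroʳ (lows s ≡ᵇ 1) = unfound
  ...   | inj₂ (inj₁ 1+i≡2+i) = contradiction (suc-injective 1+i≡2+i) (<⇒≢ (n<1+n _))
  ...   | inj₂ (inj₂ b≤1+i)   = contradiction (<-≤-trans x<b b≤1+i) (<-irrefl refl)
... | high | is-high refl = unfound , λ _ → inj₁ refl
... | other | is-other _ _ x≢2+i = unfound , λ seen → skip-letter x≢2+i (clean seen)

CleanAt-ascent : ∀ i b x k s → x + k ≤ b → CleanAt i b x s → CleanAt i b (x + k) (scanWord i s (ascent x k))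
CleanAt-ascent i b x zero    s _ p = subst (λ z → CleanAt i b z s) (sym (+-identityʳ x)) p
CleanAt-ascent i b x (suc k) s x+1+k≤b p =
  subst (λ z → CleanAt i b z (scanWord i (step s (role i x)) (ascent (suc x) k))) (sym (+-suc x k))
    (CleanAt-ascent i b (suc x) k (step s (role i x)) (subst (_≤ b) (+-suc x k) x+1+k≤b)
      (CleanAt-step i b x s (<-≤-trans (m<m+n x (s≤s z≤n)) x+1+k≤b) p))

Clean : ℕ → ℕ → Scan → Set
Clean i b s = found s ≡ false × (seenMid s ≡ true → sawHigh s ≡ true ⊎ b ≤ suc i)

canonical-unfound : ∀ i {b l} → Canonical b l → ∀ s → Clean i b s → found (scanWord i s l) ≡ false
canonical-unfound i []            s (unfound , _) = unfound
canonical-unfound i {b} (run {r = r} c k t<b p) s (unfound , clean)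
  rewrite foldl-++ (scanStep i) s (ascent (suc c) (suc k)) r =
  canonical-unfound i p _ (proj₁ after , λ seen → next-top (proj₂ after seen))
  where
  after : CleanAt i b (suc c + suc k) (scanWord i s (ascent (suc c) (suc k)))
  after = CleanAt-ascent i b (suc c) (suc k) s (subst (_≤ b) (cong suc (sym (+-suc c k))) t<b)
            (unfound , λ seen → Data.Sum.map₂ inj₂ (clean seen))
  next-top : ∀ {t} → t ≡ true ⊎ suc c + suc k ≡ suc (suc i) ⊎ b ≤ suc i → t ≡ true ⊎ suc (c + k) ≤ suc i
  next-top (inj₁ saw)          = inj₁ saw
  next-top (inj₂ (inj₁ e))      = inj₂ (≤-reflexive (suc-injective (trans (cong suc (sym (+-suc c k))) e)))
  next-top (inj₂ (inj₂ b≤1+i)) = inj₂ (≤-trans (<⇒≤ t<b) b≤1+i)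

canonical-scan : ∀ i {b l} → Canonical b l → found (scanWord i start l) ≡ false
canonical-scan i p = canonical-unfound i p start (refl , λ ())

-- Reduced words with properties (1)–(3) are canonical

record Admissible (l : List ℕ) : Set where
  field
    rises-slowly    : ∀ u x y v → l ≡ u ++ x ∷ y ∷ v → y ≤ suc x
    no-repeat       : ∀ u x v → l ≢ u ++ x ∷ x ∷ v
    no-hidden-braid : ∀ u e xs v → All (_< e) xs → l ≢ u ++ suc e ∷ xs ++ e ∷ suc e ∷ v

admissible-suffix : ∀ p {l} → Admissible (p ++ l) → Admissible l
admissible-suffix p adm = record
  { rises-slowly    = λ u x y v e → rises-slowly (p ++ u) x y v (shift u e)
  ; no-repeat       = λ u x v e → no-repeat (p ++ u) x v (shift u e)
  ; no-hidden-braid = λ u e xs v xs<e eq → no-hidden-braid (p ++ u) e xs v xs<e (shift u eq)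
  }
  where
  open Admissible adm
  shift : ∀ u {l w} → l ≡ u ++ w → p ++ l ≡ (p ++ u) ++ w
  shift u {w = w} refl = sym (++-assoc p u w)

-- If a run s_(c′+1) ⋯ s_(c′+j′+1) starting below e followed the letter e + 1 and reached e,
-- then e + 1 could be commuted up to the factor s_e s_(e+1).
hidden-braid-bound : ∀ p e c′ j′ {r} → Admissible (p ++ suc e ∷ ascent (suc c′) (suc j′) ++ r) →
                     c′ < e → c′ + j′ < e
hidden-braid-bound p e c′ j′ {r} adm c′<e with c′ + j′ <? e
... | yes c′+j′<e = c′+j′<e
... | no  c′+j′≮e with m≤n⇒∃[o]m+o≡n c′<e
...   | d , refl with m≤n⇒∃[o]m+o≡n (≮⇒≥ c′+j′≮e)
...     | t , e+t≡c′+j′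
  with refl ← +-cancelˡ-≡ c′ j′ (suc (d + t))
                (sym (trans (+-suc c′ (d + t)) (trans (cong suc (sym (+-assoc c′ d t))) e+t≡c′+j′))) =
  ⊥-elim (Admissible.no-hidden-braid adm p e (ascent (suc c′) d) (ascent (suc (suc e)) t ++ r)
    (ascent-all (suc c′) d λ _ x<e → x<e)
    (cong (λ z → p ++ suc e ∷ z) (begin
      ascent (suc c′) (suc (suc (d + t))) ++ r            ≡⟨ cong (λ m → ascent (suc c′) m ++ r) (trans (+-suc d (suc t)) (cong suc (+-suc d t))) ⟨
      ascent (suc c′) (d + suc (suc t)) ++ r               ≡⟨ cong (_++ r) (ascent-++ (suc c′) d (suc (suc t))) ⟩
      (ascent (suc c′) d ++ ascent e (suc (suc t))) ++ r   ≡⟨ ++-assoc (ascent (suc c′) d) (ascent e (suc (suc t))) r ⟩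
      ascent (suc c′) d ++ e ∷ suc e ∷ ascent (suc (suc e)) t ++ r ∎)))
  where open ≡-Reasoning

ascent-top-split : ∀ c k w → ascent (suc c) (suc k) ++ w ≡ ascent (suc c) k ++ suc (c + k) ∷ w
ascent-top-split c k w = trans (cong (_++ w) (ascent-snoc (suc c) k)) (++-assoc (ascent (suc c) k) [ suc (c + k) ] w)

ascent-extend : ∀ c k w → ascent (suc c) (suc k) ++ suc (suc (c + k)) ∷ w ≡ ascent (suc c) (suc (suc k)) ++ w
ascent-extend c k w = begin
  ascent (suc c) (suc k) ++ suc (suc (c + k)) ∷ w     ≡⟨ cong (λ z → ascent (suc c) (suc k) ++ z ∷ w) (cong suc (+-suc c k)) ⟨
  ascent (suc c) (suc k) ++ suc c + suc k ∷ w         ≡⟨ ascent-top-split c (suc k) w ⟨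
  ascent (suc c) (suc (suc k)) ++ w                   ∎
  where open ≡-Reasoning

record FirstRun (c k : ℕ) (rest : List ℕ) : Set where
  field
    j              : ℕ
    tail           : List ℕ
    split          : ascent (suc c) (suc k) ++ rest ≡ ascent (suc c) (suc j) ++ tail
    tail-canonical : Canonical (suc (c + j)) tail

parse-run : ∀ rest c k → Admissible (ascent (suc c) (suc k) ++ rest) → All (1 ≤_) rest → FirstRun c k rest
parse-run [] c k _ _ = record { j = k ; tail = [] ; split = refl ; tail-canonical = [] }
parse-run (y ∷ rest) c k adm (1≤y ∷ rest≥1)
  with m≤n⇒m<n∨m≡n (Admissible.rises-slowly adm (ascent (suc c) k) (suc (c + k)) y rest (ascent-top-split c k (y ∷ rest)))
... | inj₂ refl =
  let r = parse-run rest c (suc k) (subst Admissible (ascent-extend c k rest) adm) rest≥1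
  in record { FirstRun r ; split = trans (ascent-extend c k rest) (FirstRun.split r) }
... | inj₁ y<1+top with y | 1≤y
...   | suc c′ | _ = record
  { j = k ; tail = suc c′ ∷ rest ; split = refl
  ; tail-canonical = subst (Canonical (suc (c + k))) (sym split′)
      (run c′ j′ (s≤s (hidden-braid-bound (ascent (suc c) k) (c + k) c′ j′ adm′ c′<c+k)) tail-canonical′)
  }
  where
  open FirstRun (parse-run rest c′ 0 (admissible-suffix (ascent (suc c) (suc k)) adm) rest≥1)
    renaming (j to j′; split to split′; tail-canonical to tail-canonical′)
  c′<c+k : c′ < c + k
  c′<c+k = ≤∧≢⇒< (≤-pred (≤-pred y<1+top)) λ c′≡c+k →
    Admissible.no-repeat adm (ascent (suc c) k) (suc (c + k)) rest
      (trans (ascent-top-split c k (suc c′ ∷ rest)) (cong (λ z → ascent (suc c) k ++ suc (c + k) ∷ suc z ∷ rest) c′≡c+k))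
  adm′ : Admissible (ascent (suc c) k ++ suc (c + k) ∷ ascent (suc c′) (suc j′) ++ tail)
  adm′ = subst Admissible
    (trans (ascent-top-split c k (suc c′ ∷ rest)) (cong (λ z → ascent (suc c) k ++ suc (c + k) ∷ z) split′)) adm

All-ascent-last : ∀ {P : ℕ → Set} a j r → All P (ascent a (suc j) ++ r) → P (a + j)
All-ascent-last {P} a zero    r (pa ∷ _) = subst P (sym (+-identityʳ a)) pa
All-ascent-last {P} a (suc j) r (_ ∷ ps) = subst P (sym (+-suc a j)) (All-ascent-last (suc a) j r ps)

admissible-canonical : ∀ n l → Admissible l → All (λ z → 1 ≤ z × z < n) l → Canonical n l
admissible-canonical n []          _   _                  = []
admissible-canonical n (suc c ∷ l) adm letters@(_ ∷ rest) = subst (Canonical n) (sym split)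
  (run c j (All-ascent-last (suc c) j tail (subst (All (_< n)) split (All.map proj₂ letters))) tail-canonical)
  where open FirstRun (parse-run l c 0 adm (All.map proj₁ rest))

-- Words over Letter n and permutations of Fin n

idx-bounds : ∀ {n} (a : Letter n) → 1 ≤ idx a × idx a < n
idx-bounds {zero}  (ltr ())
idx-bounds {suc m} (ltr i) = s≤s z≤n , s≤s (toℕ<n i)

idx-injective : ∀ {n} {a b : Letter n} → idx a ≡ idx b → a ≡ b
idx-injective {a = ltr i} {ltr j} e = cong ltr (toℕ-injective (suc-injective e))

letters-bounds : ∀ {n} (w : Word n) → All (λ z → 1 ≤ z × z < n) (map idx w)
letters-bounds w = map⁺ (All.universal idx-bounds w)

letter-for : ∀ {n z} → suc z < n → Σ (Letter n) (λ a → idx a ≡ suc z)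
letter-for 1+z<n = ltr (fromℕ< (<⇒≤pred 1+z<n)) , cong suc (toℕ-fromℕ< (<⇒≤pred 1+z<n))

word-for : ∀ {n} l → All (λ z → 1 ≤ z × z < n) l → Σ (Word n) (λ w → map idx w ≡ l)
word-for []          []                 = [] , refl
word-for (suc z ∷ l) ((_ , 1+z<n) ∷ ps) with letter-for 1+z<n | word-for l ps
... | a , refl | w , refl = a ∷ w , refl

toℕ-transpose : ∀ {m} (i : Fin m) (x : Fin (suc m)) →
                toℕ (PC.transpose (inject₁ i) (F.suc i) x) ≡ swap (suc (toℕ i)) (toℕ x)
toℕ-transpose i x with x F.≟ inject₁ i
... | yes refl = sym (trans (cong (swap (suc (toℕ i))) (toℕ-inject₁ i)) (swap-lower (toℕ i)))
... | no x≢i with x F.≟ F.suc i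
...   | yes refl = trans (toℕ-inject₁ i) (sym (swap-upper (toℕ i)))
...   | no x≢1+i = sym (swap-fix (toℕ i) (toℕ x) (λ e → x≢i (toℕ-injective (trans e (sym (toℕ-inject₁ i)))))
                                                  (λ e → x≢1+i (toℕ-injective e)))

toℕ-eval : ∀ {n} (w : Word n) x → toℕ (eval w x) ≡ evalℕ (map idx w) (toℕ x)
toℕ-eval {zero}  []          x = refl
toℕ-eval {zero}  (ltr () ∷ w) x
toℕ-eval {suc m} []          x = refl
toℕ-eval {suc m} (ltr i ∷ w) x = trans (toℕ-transpose i (eval w x)) (cong (swap (suc (toℕ i))) (toℕ-eval w x))

map-++⁻ : ∀ {A B : Set} (f : A → B) xs {u v} → map f xs ≡ u ++ v →
          ∃₂ λ U V → xs ≡ U ++ V × map f U ≡ u × map f V ≡ v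
map-++⁻ f xs       {[]}    refl = [] , xs , refl , refl , refl
map-++⁻ f (x ∷ xs) {y ∷ u} eq with ∷-injective eq
... | refl , eq′ with map-++⁻ f xs {u} eq′
...   | U , V , refl , refl , refl = x ∷ U , V , refl , refl , refl

map-∷⁻ : ∀ {A B : Set} (f : A → B) xs {y v} → map f xs ≡ y ∷ v →
         ∃₂ λ a V → xs ≡ a ∷ V × f a ≡ y × map f V ≡ v
map-∷⁻ f (x ∷ xs) refl = x , xs , refl , refl , refl

letters-infix : ∀ {n} (w : Word n) u {x y v} → map idx w ≡ u ++ x ∷ y ∷ v →
                ∃₂ λ U V → ∃₂ λ a b → w ≡ U ++ a ∷ b ∷ V × idx a ≡ x × idx b ≡ y
letters-infix w u eq with map-++⁻ idx w {u} eq
... | U , W , refl , _ , eqW with map-∷⁻ idx W eqW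
...   | a , W′ , refl , refl , eqW′ with map-∷⁻ idx W′ eqW′
...     | b , V , refl , refl , _ = U , V , a , b , refl , refl , refl

eval-++ : ∀ {n} (u v : Word n) x → eval (u ++ v) x ≡ eval u (eval v x)
eval-++ []      v x = refl
eval-++ (a ∷ u) v x = cong (s _ a ⟨$⟩ʳ_) (eval-++ u v x)

eval-cancel : ∀ {n} (u : Word n) a v x → eval (u ++ a ∷ a ∷ v) x ≡ eval (u ++ v) x
eval-cancel u a v x = begin
  eval (u ++ a ∷ a ∷ v) x     ≡⟨ eval-++ u (a ∷ a ∷ v) x ⟩
  eval u (eval (a ∷ a ∷ v) x) ≡⟨ cong (eval u) (toℕ-injective (trans (toℕ-eval (a ∷ a ∷ v) x)
                                   (trans (swap-involutive (idx a) _) (sym (toℕ-eval v x))))) ⟩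
  eval u (eval v x)           ≡⟨ eval-++ u v x ⟨
  eval (u ++ v) x             ∎
  where open ≡-Reasoning

scanWord-∼ᶜ : ∀ {n} i s {w w′ : Word n} → w ∼ᶜ w′ → scanWord i s (map idx w) ≡ scanWord i s (map idx w′)
scanWord-∼ᶜ i s ε                            = refl
scanWord-∼ᶜ i s (comm u v a b far ◅ w∼w′) = trans swapped (scanWord-∼ᶜ i s w∼w′)
  where
  swapped : scanWord i s (map idx (u ++ a ∷ b ∷ v)) ≡ scanWord i s (map idx (u ++ b ∷ a ∷ v))
  swapped rewrite map-++ idx u (a ∷ b ∷ v) | map-++ idx u (b ∷ a ∷ v) =
    scanWord-far-swap i s (map idx u) (idx a) (idx b) (map idx v) far

canonical⇒good : ∀ {n} {w : Word n} → Canonical n (map idx w) → Good w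
canonical⇒good {w = w} can = no-bad-ascent , no-braid w ε , no-braid
  where
  no-bad-ascent : ¬ HasBadAscent w
  no-bad-ascent (u , v , a , b , refl , 1+a<b) =
    ≤⇒≯ (linked-infix (map idx u) (subst (Linked UpByAtMostOne) (map-++ idx u (a ∷ b ∷ v)) (Linked.tail (canonical-linked can))))
        1+a<b
  no-braid : ∀ w′ → w ∼ᶜ w′ → ¬ HasPattern w′
  no-braid w′ w∼w′ (u , v , a , b , refl , a≡1+b) = contradiction (begin
    false                                                       ≡⟨ canonical-scan (idx b) can ⟨
    found (scanWord (idx b) start (map idx w))                  ≡⟨ cong found (scanWord-∼ᶜ (idx b) start w∼w′) ⟩
    found (scanWord (idx b) start (map idx (u ++ a ∷ b ∷ a ∷ v))) ≡⟨ cong (found ∘ scanWord (idx b) start)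
                                                                     (trans (map-++ idx u (a ∷ b ∷ a ∷ v))
                                                                       (cong (λ x → map idx u ++ x ∷ idx b ∷ x ∷ map idx v) a≡1+b)) ⟩
    found (scanWord (idx b) start (map idx u ++ suc (idx b) ∷ idx b ∷ suc (idx b) ∷ map idx v))
                                                                ≡⟨ scanWord-braid (idx b) start (map idx u) (map idx v) ⟩
    true                                                        ∎) λ ()
    where open ≡-Reasoning

commute-past : ∀ {n} (u xs v : Word n) a → All (λ c → suc (idx c) < idx a) xs → (u ++ a ∷ xs ++ v) ∼ᶜ (u ++ xs ++ a ∷ v)
commute-past u []       v a []           = ε
commute-past u (c ∷ xs) v a (c≪a ∷ xs≪a) = comm u (xs ++ v) a c (inj₂ c≪a) ◅
  subst₂ _∼ᶜ_ (++-assoc u [ c ] (a ∷ xs ++ v)) (++-assoc u [ c ] (xs ++ a ∷ v)) (commute-past (u ++ [ c ]) xs v a xs≪a)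

hidden-braid-commutes : ∀ {n} (w : Word n) u e xs v → All (_< e) xs →
                        map idx w ≡ u ++ suc e ∷ xs ++ e ∷ suc e ∷ v → ∃ λ w′ → w ∼ᶜ w′ × HasPattern w′
hidden-braid-commutes w u e xs v xs<e eq
  with map-++⁻ idx w {u} eq
... | U , W₁ , refl , _ , eq₁ with map-∷⁻ idx W₁ eq₁
... | a , W₂ , refl , a≡1+e , eq₂ with map-++⁻ idx W₂ {xs} eq₂
... | X , W₃ , refl , X≡xs , eq₃ with map-∷⁻ idx W₃ eq₃
... | c , W₄ , refl , refl , eq₄ with map-∷⁻ idx W₄ eq₄
... | b , V , refl , b≡1+e , _ with refl ← idx-injective (trans b≡1+e (sym a≡1+e)) =
  U ++ X ++ a ∷ c ∷ a ∷ V ,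
  commute-past U X (c ∷ a ∷ V) a
    (All.map (λ {x} x<e → subst (suc (idx x) <_) (sym a≡1+e) (s≤s x<e)) (map⁻ (subst (All (_< idx c)) (sym X≡xs) xs<e))) ,
  (U ++ X , V , a , c , sym (++-assoc U X (a ∷ c ∷ a ∷ V)) , a≡1+e)

module OnNaturals {n : ℕ} (σ : Permutation′ n) where

  σℕ : ℕ → ℕ
  σℕ x with x <? n
  ... | yes x<n = toℕ (σ ⟨$⟩ʳ fromℕ< x<n)
  ... | no  _   = x

  σℕ-< : ∀ {x} (x<n : x < n) → σℕ x ≡ toℕ (σ ⟨$⟩ʳ fromℕ< x<n)
  σℕ-< {x} x<n with x <? n
  ... | yes _   = refl
  ... | no  x≮n = contradiction x<n x≮n

  σℕ-toℕ : ∀ x → σℕ (toℕ x) ≡ toℕ (σ ⟨$⟩ʳ x)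
  σℕ-toℕ x = trans (σℕ-< (toℕ<n x)) (cong (λ y → toℕ (σ ⟨$⟩ʳ y)) (fromℕ<-toℕ x (toℕ<n x)))

  σℕ-perm : IsPermutationOn n σℕ
  σℕ-perm = record
    { maps-to   = λ x<n → subst (_< n) (sym (σℕ-< x<n)) (toℕ<n _)
    ; injective = λ {x} {y} x<n y<n σx≡σy → begin
        x                                          ≡⟨ toℕ-fromℕ< x<n ⟨
        toℕ (fromℕ< x<n)                           ≡⟨ cong toℕ (Perm.inverseˡ σ) ⟨
        toℕ (σ ⟨$⟩ˡ (σ ⟨$⟩ʳ fromℕ< x<n))          ≡⟨ cong (λ z → toℕ (σ ⟨$⟩ˡ z)) (toℕ-injective
                                                         (trans (sym (σℕ-< x<n)) (trans σx≡σy (σℕ-< y<n)))) ⟩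
        toℕ (σ ⟨$⟩ˡ (σ ⟨$⟩ʳ fromℕ< y<n))          ≡⟨ cong toℕ (Perm.inverseˡ σ) ⟩
        toℕ (fromℕ< y<n)                           ≡⟨ toℕ-fromℕ< y<n ⟩
        y                                          ∎
    }
    where open ≡-Reasoning

  Evaluates : Word n → Set
  Evaluates w = ∀ x → eval w x ≡ σ ⟨$⟩ʳ x

  evaluates⇒represents : ∀ w → Evaluates w → ∀ {x} → x < n → evalℕ (map idx w) x ≡ σℕ x
  evaluates⇒represents w ev {x} x<n = begin
    evalℕ (map idx w) x                      ≡⟨ cong (evalℕ (map idx w)) (toℕ-fromℕ< x<n) ⟨
    evalℕ (map idx w) (toℕ (fromℕ< x<n))     ≡⟨ toℕ-eval w (fromℕ< x<n) ⟨
    toℕ (eval w (fromℕ< x<n))                ≡⟨ cong toℕ (ev (fromℕ< x<n)) ⟩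
    toℕ (σ ⟨$⟩ʳ fromℕ< x<n)                  ≡⟨ σℕ-< x<n ⟨
    σℕ x                                     ∎
    where open ≡-Reasoning

  represents⇒evaluates : ∀ w → (∀ {x} → x < n → evalℕ (map idx w) x ≡ σℕ x) → Evaluates w
  represents⇒evaluates w rep x = toℕ-injective (trans (toℕ-eval w x) (trans (rep (toℕ<n x)) (σℕ-toℕ x)))

  canonical-word : Σ (Word n) λ w → Canonical n (map idx w) × Evaluates w × length w ≡ inversions (oneLine n σℕ)
  canonical-word = w , subst (Canonical n) (sym letters≡) canonical
                     , represents⇒evaluates w (λ {x} x<n → trans (cong (λ l → evalℕ l x) letters≡) (represents x<n))
                     , trans (sym (length-map idx w)) (trans (cong length letters≡) length≡inversions)
    where
    open CanonicalFor (canonical-exists n σℕ-perm)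
    w : Word n
    w = proj₁ (word-for word (Canonical-letters canonical))
    letters≡ : map idx w ≡ word
    letters≡ = proj₂ (word-for word (Canonical-letters canonical))

  inversions≤length-word : ∀ w → Evaluates w → inversions (oneLine n σℕ) ≤ length w
  inversions≤length-word w ev = subst (_ ≤_) (length-map idx w)
    (inversions≤length (map idx w) σℕ (All.map proj₂ (letters-bounds w)) (evaluates⇒represents w ev))

  canonical-word-unique : ∀ w w′ → Canonical n (map idx w) → Canonical n (map idx w′) →
                          Evaluates w → Evaluates w′ → w ≡ w′
  canonical-word-unique w w′ can can′ ev ev′ = map-injective idx-injective (canonical-unique n can can′
    (λ x<n → trans (evaluates⇒represents w ev x<n) (sym (evaluates⇒represents w′ ev′ x<n))))

  reduced-good⇒admissible : ∀ {w} → IsReducedExprFor w σ → Good w → Admissible (map idx w)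
  reduced-good⇒admissible {w} (ev , minimal) (no-bad-ascent , _ , no-braid) = record
    { rises-slowly    = rises-slowly
    ; no-repeat       = no-repeat
    ; no-hidden-braid = λ u e xs v xs<e eq →
        let w′ , w∼w′ , braid = hidden-braid-commutes w u e xs v xs<e eq in no-braid w′ w∼w′ braid
    }
    where
    rises-slowly : ∀ u x y v → map idx w ≡ u ++ x ∷ y ∷ v → y ≤ suc x
    rises-slowly u x y v eq with letters-infix w u eq
    ... | U , V , a , b , refl , refl , refl = ≮⇒≥ (λ 1+a<b → no-bad-ascent (U , V , a , b , refl , 1+a<b))
    no-repeat : ∀ u x v → map idx w ≢ u ++ x ∷ x ∷ v
    no-repeat u x v eq with letters-infix w u eq
    ... | U , V , a , b , refl , a≡x , b≡x with refl ← idx-injective (trans a≡x (sym b≡x)) =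
      <⇒≱ shorter (minimal (U ++ V) (λ x → trans (sym (eval-cancel U a V x)) (ev x)))
      where
      shorter : length (U ++ V) < length (U ++ a ∷ a ∷ V)
      shorter rewrite length-++ U {V} | length-++ U {a ∷ a ∷ V} = +-monoʳ-< (length U) (m<n⇒m<1+n (n<1+n _))

  reduced-good⇒canonical : ∀ {w} → IsReducedExprFor w σ → Good w → Canonical n (map idx w)
  reduced-good⇒canonical {w} red good = admissible-canonical n (map idx w) (reduced-good⇒admissible red good) (letters-bounds w)

theorem5p2 : (n : ℕ) (σ : Permutation′ n) →
    ∃ λ (w : Word n) → (IsReducedExprFor w σ × Good w) ×
      (∀ (w′ : Word n) → IsReducedExprFor w′ σ × Good w′ → w′ ≡ w)
theorem5p2 n σ with OnNaturals.canonical-word σ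
... | w , can , ev , length≡ = w , ((ev , minimal) , canonical⇒good can) , unique
  where
  open OnNaturals σ
  minimal : ∀ w′ → Evaluates w′ → length w ≤ length w′
  minimal w′ ev′ = subst (_≤ length w′) (sym length≡) (inversions≤length-word w′ ev′)
  unique : ∀ w′ → IsReducedExprFor w′ σ × Good w′ → w′ ≡ w
  unique w′ (red′ , good′) = canonical-word-unique w′ w (reduced-good⇒canonical red′ good′) can (proj₁ red′) ev
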